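{- Let $\Gamma\cup\{A\}\subseteq\mathsf{Form}_Q$ be a set of reduced formulas. Then $\Gamma\vdash_{i3}A$ if and only if $\Gamma',E_{\Gamma\cup\{A\}}\vdash_{mh}A'$.
   Context: $\mathcal{L}_Q$: first-order language with $\bot,{\sim},\land,\lor,\to,\forall,\exists$, countably many constants, variables and predicate symbols; $\mathsf{Form}_Q$ its formulas; $\neg A:=A\to\bot$, $A\leftrightarrow B:=(A\to B)\land(B\to A)$. $\mathbf{QBDi3}$ is the Hilbert system with axioms (Ax1) $A\to(B\to A)$; (Ax2) $(A\to(B\to C))\to((A\to B)\to(A\to C))$; (Ax4) $(A\land B)\to A$; (Ax5) $(A\land B)\to B$; (Ax6) $(C\to A)\to((C\to B)\to(C\to(A\land B)))$; (Ax7) $A\to(A\lor B)$; (Ax8) $B\to(A\lor B)$; (Ax9) $(A\to C)\to((B\to C)\to((A\lor B)\to C))$; (Ax10) $\bot\to A$; (Ax11) $A(t)\to\exists xA$; (Ax12) $\forall x(A(x)\to B)\to(\exists xA(x)\to B)$ ($x$ not free in $B$); (Ax13) $\forall x(B\to A)\to(B\to\forall xA)$ ($x$ not free in $B$); (Ax14) $\forall xA\to A(t)$; (Ax15) $A\to{\sim}\bot$; (Ax16) ${\sim}{\sim}A\leftrightarrow A$; (Ax17) ${\sim}(A\land B)\leftrightarrow({\sim}A\lor{\sim}B)$; (Ax18) ${\sim}(A\lor B)\leftrightarrow({\sim}A\land{\sim}B)$; (Ax19) ${\sim}(A\to B)\leftrightarrow(\neg{\sim}A\land{\sim}B)$; (Ax20)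 ${\sim}\forall xA\leftrightarrow\exists x{\sim}A$; (Ax21) ${\sim}\exists xA\leftrightarrow\forall x{\sim}A$; (i1) $\forall x\neg\neg A\to\neg\neg\forall xA$; (i2) ${\sim}A\to\neg A$; (i3) $\neg\neg(A\lor{\sim}A)$; rules MP and Gen (from $A$ infer $\forall xA$). $\Gamma\vdash_{i3}A$ means there is a finite list ending in $A$ each item of which is in $\Gamma$, an axiom instance, or follows from earlier items by MP or Gen. Reduction $f$: $f(P)=P$, $f({\sim}P)={\sim}P$ ($P$ atomic), $f(\bot)=\bot$, $f({\sim}\bot)={\sim}\bot$, $f(A\circ B)=f(A)\circ f(B)$ ($\circ\in\{\land,\lor,\to\}$), $f(QxA)=Qxf(A)$, $f({\sim}{\sim}A)=f(A)$, $f({\sim}(A\land B))=f({\sim}A)\lor f({\sim}B)$, $f({\sim}(A\lor B))=f({\sim}A)\land f({\sim}B)$, $f({\sim}(A\to B))=\neg f({\sim}A)\land f({\sim}B)$, $f({\sim}\forall xA)=\exists xf({\sim}A)$, $f({\sim}\exists xA)=\forall xf({\sim}A)$. A formula is reduced if it equals $f(B)$ for some $B$; in a reduced formula ${\sim}$ is applied only to atomic formulas or $\bot$. $\mathcal{L}_{int}$ is the language with $\bot$, a nullary constant ${\sim}\bot$, $\land,\lor,\to,\forall,\exists$, the predicate symbols of $\mathcal{L}_Q$ and for each predicate $P$ a fresh predicate $P'$ of the same arity. $\mathbf{MH}$ is the Hilbert system in $\mathcal{L}_{int}$ with axioms Ax1, Ax2, Ax4–Ax14, Ax15 ($A\to{\sim}\bot$),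 (i1) and rules MP, Gen; $\vdash_{mh}$ denotes its derivability. For a reduced formula $A$, $A'$ is obtained by replacing every occurrence of ${\sim}P(\vec t)$ ($P$ atomic predicate) by $P'(\vec t)$; $\Gamma'=\{B':B\in\Gamma\}$. For a set $\Gamma$ of reduced formulas, $E_\Gamma=\{\forall\vec x(P'(\vec x)\to\neg P(\vec x)):{\sim}P\text{ occurs in some }B\in\Gamma\}\cup\{\forall\vec x\neg\neg(P'(\vec x)\lor P(\vec x)):{\sim}P\text{ occurs in some }B\in\Gamma\}$. -}

module Defs where

open import Data.Nat using (ℕ; zero; suc; _≡ᵇ_)
open import Data.Bool using (Bool; true; false; not; if_then_else_; T)
  renaming (_∧_ to _&&_; _∨_ to _||_)
open import Data.Vec using (Vec; []; _∷_; map)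
open import Data.Product using (Σ; _×_; _,_)
open import Data.Sum using (_⊎_)
open import Data.Empty using (⊥)
open import Relation.Binary.PropositionalEquality using (_≡_)

data Term : Set where
  var : ℕ → Term
  con : ℕ → Term

occT : ℕ → Term → Bool
occT x (var y) = x ≡ᵇ y
occT x (con _) = false

occTs : ∀ {n} → ℕ → Vec Term n → Bool
occTs x []       = false
occTs x (t ∷ ts) = occT x t || occTs x ts

substT : ℕ → Term → Term → Term
substT x s (var y) = if x ≡ᵇ y then s else var y
substT x s (con c) = con c

-- The language L_Q.  A predicate symbol is a pair (name p, arity n),
-- giving countably many predicate symbols.

infixr 5 _⇒_
infixr 6 _⋁_
infixr 7 _⋀_
infix  8 ∼_
infix  4 _⇔'_

data Form : Set where
  atom : (p : ℕ) (n : ℕ) → Vec Term n → Form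
  fls  : Form
  ∼_   : Form → Form                  -- strong negation ~
  _⋀_  : Form → Form → Form
  _⋁_  : Form → Form → Form
  _⇒_  : Form → Form → Form
  ∀'   : ℕ → Form → Form
  ∃'   : ℕ → Form → Form

¬' : Form → Form
¬' A = A ⇒ fls

_⇔'_ : Form → Form → Form
A ⇔' B = (A ⇒ B) ⋀ (B ⇒ A)

fv : ℕ → Form → Bool
fv x (atom p n ts) = occTs x ts
fv x fls           = false
fv x (∼ A)         = fv x A
fv x (A ⋀ B)       = fv x A || fv x B
fv x (A ⋁ B)       = fv x A || fv x B
fv x (A ⇒ B)       = fv x A || fv x B
fv x (∀' y A)      = not (x ≡ᵇ y) && fv x A
fv x (∃' y A)      = not (x ≡ᵇ y) && fv x A

sub : ℕ → Term → Form → Form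
sub x t (atom p n ts) = atom p n (map (substT x t) ts)
sub x t fls           = fls
sub x t (∼ A)         = ∼ sub x t A
sub x t (A ⋀ B)       = sub x t A ⋀ sub x t B
sub x t (A ⋁ B)       = sub x t A ⋁ sub x t B
sub x t (A ⇒ B)       = sub x t A ⇒ sub x t B
sub x t (∀' y A)      = if x ≡ᵇ y then ∀' y A else ∀' y (sub x t A)
sub x t (∃' y A)      = if x ≡ᵇ y then ∃' y A else ∃' y (sub x t A)

freeFor : Term → ℕ → Form → Bool
freeFor t x (atom p n ts) = true
freeFor t x fls           = true
freeFor t x (∼ A)         = freeFor t x A
freeFor t x (A ⋀ B)       = freeFor t x A && freeFor t x B
freeFor t x (A ⋁ B)       = freeFor t x A && freeFor t x B
freeFor t x (A ⇒ B)       = freeFor t x A && freeFor t x B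
freeFor t x (∀' y A)      = not (fv x (∀' y A)) || (not (occT y t) && freeFor t x A)
freeFor t x (∃' y A)      = not (fv x (∃' y A)) || (not (occT y t) && freeFor t x A)

data AxQBDi3 : Form → Set where
  ax1  : ∀ A B → AxQBDi3 (A ⇒ (B ⇒ A))
  ax2  : ∀ A B C → AxQBDi3 ((A ⇒ (B ⇒ C)) ⇒ ((A ⇒ B) ⇒ (A ⇒ C)))
  ax4  : ∀ A B → AxQBDi3 ((A ⋀ B) ⇒ A)
  ax5  : ∀ A B → AxQBDi3 ((A ⋀ B) ⇒ B)
  ax6  : ∀ A B C → AxQBDi3 ((C ⇒ A) ⇒ ((C ⇒ B) ⇒ (C ⇒ (A ⋀ B))))
  ax7  : ∀ A B → AxQBDi3 (A ⇒ (A ⋁ B))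
  ax8  : ∀ A B → AxQBDi3 (B ⇒ (A ⋁ B))
  ax9  : ∀ A B C → AxQBDi3 ((A ⇒ C) ⇒ ((B ⇒ C) ⇒ ((A ⋁ B) ⇒ C)))
  ax10 : ∀ A → AxQBDi3 (fls ⇒ A)
  ax11 : ∀ x t A → T (freeFor t x A) → AxQBDi3 (sub x t A ⇒ ∃' x A)
  ax12 : ∀ x A B → T (not (fv x B)) → AxQBDi3 (∀' x (A ⇒ B) ⇒ (∃' x A ⇒ B))
  ax13 : ∀ x A B → T (not (fv x B)) → AxQBDi3 (∀' x (B ⇒ A) ⇒ (B ⇒ ∀' x A))
  ax14 : ∀ x t A → T (freeFor t x A) → AxQBDi3 (∀' x A ⇒ sub x t A)
  ax15 : ∀ A → AxQBDi3 (A ⇒ ∼ fls)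
  ax16 : ∀ A → AxQBDi3 ((∼ ∼ A) ⇔' A)
  ax17 : ∀ A B → AxQBDi3 (∼ (A ⋀ B) ⇔' (∼ A ⋁ ∼ B))
  ax18 : ∀ A B → AxQBDi3 (∼ (A ⋁ B) ⇔' (∼ A ⋀ ∼ B))
  ax19 : ∀ A B → AxQBDi3 (∼ (A ⇒ B) ⇔' (¬' (∼ A) ⋀ ∼ B))
  ax20 : ∀ x A → AxQBDi3 (∼ ∀' x A ⇔' ∃' x (∼ A))
  ax21 : ∀ x A → AxQBDi3 (∼ ∃' x A ⇔' ∀' x (∼ A))
  i1   : ∀ x A → AxQBDi3 (∀' x (¬' (¬' A)) ⇒ ¬' (¬' (∀' x A)))
  i2   : ∀ A → AxQBDi3 (∼ A ⇒ ¬' A)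
  i3   : ∀ A → AxQBDi3 (¬' (¬' (A ⋁ ∼ A)))

infix 3 _⊢i3_
data _⊢i3_ (Γ : Form → Set) : Form → Set where
  hyp : ∀ {A} → Γ A → Γ ⊢i3 A
  ax  : ∀ {A} → AxQBDi3 A → Γ ⊢i3 A
  mp  : ∀ {A B} → Γ ⊢i3 A → Γ ⊢i3 (A ⇒ B) → Γ ⊢i3 B
  gen : ∀ {A} x → Γ ⊢i3 A → Γ ⊢i3 ∀' x A

-- The reduction f  (fneg A stands for f(~A))

mutual
  f : Form → Form
  f (atom p n ts) = atom p n ts
  f fls           = fls
  f (∼ A)         = fneg A
  f (A ⋀ B)       = f A ⋀ f B
  f (A ⋁ B)       = f A ⋁ f B
  f (A ⇒ B)       = f A ⇒ f B
  f (∀' x A)      = ∀' x (f A)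
  f (∃' x A)      = ∃' x (f A)

  fneg : Form → Form
  fneg (atom p n ts) = ∼ atom p n ts
  fneg fls           = ∼ fls
  fneg (∼ A)         = f A
  fneg (A ⋀ B)       = fneg A ⋁ fneg B
  fneg (A ⋁ B)       = fneg A ⋀ fneg B
  fneg (A ⇒ B)       = ¬' (fneg A) ⋀ fneg B
  fneg (∀' x A)      = ∃' x (fneg A)
  fneg (∃' x A)      = ∀' x (fneg A)

Reduced : Form → Set
Reduced A = Σ Form (λ B → f B ≡ A)

-- The language L_int: predicate symbols P (flag false) and P' (flag true),
-- ⊥ and the nullary constant ~⊥.

infixr 5 _⇒ᵢ_
infixr 6 _⋁ᵢ_
infixr 7 _⋀ᵢ_

data FormI : Set where
  atomI : (primed : Bool) (p : ℕ) (n : ℕ) → Vec Term n → FormI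
  flsI  : FormI
  nflsI : FormI                       -- the constant ~⊥
  _⋀ᵢ_  : FormI → FormI → FormI
  _⋁ᵢ_  : FormI → FormI → FormI
  _⇒ᵢ_  : FormI → FormI → FormI
  ∀ᵢ    : ℕ → FormI → FormI
  ∃ᵢ    : ℕ → FormI → FormI

¬ᵢ : FormI → FormI
¬ᵢ A = A ⇒ᵢ flsI

fvI : ℕ → FormI → Bool
fvI x (atomI b p n ts) = occTs x ts
fvI x flsI             = false
fvI x nflsI            = false
fvI x (A ⋀ᵢ B)         = fvI x A || fvI x B
fvI x (A ⋁ᵢ B)         = fvI x A || fvI x B
fvI x (A ⇒ᵢ B)         = fvI x A || fvI x B
fvI x (∀ᵢ y A)         = not (x ≡ᵇ y) && fvI x A
fvI x (∃ᵢ y A)         = not (x ≡ᵇ y) && fvI x A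

subI : ℕ → Term → FormI → FormI
subI x t (atomI b p n ts) = atomI b p n (map (substT x t) ts)
subI x t flsI             = flsI
subI x t nflsI            = nflsI
subI x t (A ⋀ᵢ B)         = subI x t A ⋀ᵢ subI x t B
subI x t (A ⋁ᵢ B)         = subI x t A ⋁ᵢ subI x t B
subI x t (A ⇒ᵢ B)         = subI x t A ⇒ᵢ subI x t B
subI x t (∀ᵢ y A)         = if x ≡ᵇ y then ∀ᵢ y A else ∀ᵢ y (subI x t A)
subI x t (∃ᵢ y A)         = if x ≡ᵇ y then ∃ᵢ y A else ∃ᵢ y (subI x t A)

freeForI : Term → ℕ → FormI → Bool
freeForI t x (atomI b p n ts) = true
freeForI t x flsI             = true
freeForI t x nflsI            = true
freeForI t x (A ⋀ᵢ B)         = freeForI t x A && freeForI t x B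
freeForI t x (A ⋁ᵢ B)         = freeForI t x A && freeForI t x B
freeForI t x (A ⇒ᵢ B)         = freeForI t x A && freeForI t x B
freeForI t x (∀ᵢ y A)         = not (fvI x (∀ᵢ y A)) || (not (occT y t) && freeForI t x A)
freeForI t x (∃ᵢ y A)         = not (fvI x (∃ᵢ y A)) || (not (occT y t) && freeForI t x A)

data AxMH : FormI → Set where
  ax1  : ∀ A B → AxMH (A ⇒ᵢ (B ⇒ᵢ A))
  ax2  : ∀ A B C → AxMH ((A ⇒ᵢ (B ⇒ᵢ C)) ⇒ᵢ ((A ⇒ᵢ B) ⇒ᵢ (A ⇒ᵢ C)))
  ax4  : ∀ A B → AxMH ((A ⋀ᵢ B) ⇒ᵢ A)
  ax5  : ∀ A B → AxMH ((A ⋀ᵢ B) ⇒ᵢ B)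
  ax6  : ∀ A B C → AxMH ((C ⇒ᵢ A) ⇒ᵢ ((C ⇒ᵢ B) ⇒ᵢ (C ⇒ᵢ (A ⋀ᵢ B))))
  ax7  : ∀ A B → AxMH (A ⇒ᵢ (A ⋁ᵢ B))
  ax8  : ∀ A B → AxMH (B ⇒ᵢ (A ⋁ᵢ B))
  ax9  : ∀ A B C → AxMH ((A ⇒ᵢ C) ⇒ᵢ ((B ⇒ᵢ C) ⇒ᵢ ((A ⋁ᵢ B) ⇒ᵢ C)))
  ax10 : ∀ A → AxMH (flsI ⇒ᵢ A)
  ax11 : ∀ x t A → T (freeForI t x A) → AxMH (subI x t A ⇒ᵢ ∃ᵢ x A)
  ax12 : ∀ x A B → T (not (fvI x B)) → AxMH (∀ᵢ x (A ⇒ᵢ B) ⇒ᵢ (∃ᵢ x A ⇒ᵢ B))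
  ax13 : ∀ x A B → T (not (fvI x B)) → AxMH (∀ᵢ x (B ⇒ᵢ A) ⇒ᵢ (B ⇒ᵢ ∀ᵢ x A))
  ax14 : ∀ x t A → T (freeForI t x A) → AxMH (∀ᵢ x A ⇒ᵢ subI x t A)
  ax15 : ∀ A → AxMH (A ⇒ᵢ nflsI)
  i1   : ∀ x A → AxMH (∀ᵢ x (¬ᵢ (¬ᵢ A)) ⇒ᵢ ¬ᵢ (¬ᵢ (∀ᵢ x A)))

infix 3 _⊢mh_
data _⊢mh_ (Δ : FormI → Set) : FormI → Set where
  hyp : ∀ {A} → Δ A → Δ ⊢mh A
  ax  : ∀ {A} → AxMH A → Δ ⊢mh A
  mp  : ∀ {A B} → Δ ⊢mh A → Δ ⊢mh (A ⇒ᵢ B) → Δ ⊢mh B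
  gen : ∀ {A} x → Δ ⊢mh A → Δ ⊢mh ∀ᵢ x A

-- The translation A ↦ A' (meaningful on reduced formulas, where ~ only
-- precedes atoms or ⊥; the remaining ~-case is junk and never used).

prime : Form → FormI
prime (atom p n ts)     = atomI false p n ts
prime fls               = flsI
prime (∼ atom p n ts)   = atomI true p n ts
prime (∼ fls)           = nflsI
prime (∼ _)             = flsI
prime (A ⋀ B)           = prime A ⋀ᵢ prime B
prime (A ⋁ B)           = prime A ⋁ᵢ prime B
prime (A ⇒ B)           = prime A ⇒ᵢ prime B
prime (∀' x A)          = ∀ᵢ x (prime A)
prime (∃' x A)          = ∃ᵢ x (prime A)

primeSet : (Form → Set) → (FormI → Set)
primeSet Γ C = Σ Form (λ B → Γ B × prime B ≡ C)

_∪｛_｝ : (Form → Set) → Form → (Form → Set)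
(Γ ∪｛ A ｝) B = Γ B ⊎ B ≡ A

_∪ᵢ_ : (FormI → Set) → (FormI → Set) → (FormI → Set)
(Δ ∪ᵢ Θ) C = Δ C ⊎ Θ C

IsAtom : ℕ → ℕ → Form → Set
IsAtom p n (atom q m ts) = p ≡ q × n ≡ m
IsAtom p n _             = ⊥

NegOccurs : ℕ → ℕ → Form → Set
NegOccurs p n (atom q m ts) = ⊥
NegOccurs p n fls           = ⊥
NegOccurs p n (∼ A)         = IsAtom p n A ⊎ NegOccurs p n A
NegOccurs p n (A ⋀ B)       = NegOccurs p n A ⊎ NegOccurs p n B
NegOccurs p n (A ⋁ B)       = NegOccurs p n A ⊎ NegOccurs p n B
NegOccurs p n (A ⇒ B)       = NegOccurs p n A ⊎ NegOccurs p n B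
NegOccurs p n (∀' x A)      = NegOccurs p n A
NegOccurs p n (∃' x A)      = NegOccurs p n A

varsFrom : ℕ → (n : ℕ) → Vec Term n
varsFrom k zero    = []
varsFrom k (suc n) = var k ∷ varsFrom (suc k) n

allFrom : ℕ → ℕ → FormI → FormI
allFrom k zero    A = A
allFrom k (suc n) A = ∀ᵢ k (allFrom (suc k) n A)

exclAx : ℕ → ℕ → FormI
exclAx p n = allFrom 0 n (atomI true p n (varsFrom 0 n) ⇒ᵢ ¬ᵢ (atomI false p n (varsFrom 0 n)))

lemAx : ℕ → ℕ → FormI
lemAx p n = allFrom 0 n (¬ᵢ (¬ᵢ (atomI true p n (varsFrom 0 n) ⋁ᵢ atomI false p n (varsFrom 0 n))))

E : (Form → Set) → (FormI → Set)
E Γ C = Σ ℕ (λ p → Σ ℕ (λ n →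
          Σ Form (λ B → Γ B × NegOccurs p n B) × (C ≡ exclAx p n ⊎ C ≡ lemAx p n)))

-- Backwards, reading P' as ∼P sends
-- MH-derivations to QBDi3-derivations; on reduced formulas this undoes ′, and
-- the members of E become instances of i2 and i3.  Forwards, ∼ is pushed
-- inwards as in the reduction f, with ∼P read as P' when ∼P occurs in the
-- premisses and as ¬P otherwise.  Every ∼-axiom then translates to an identity,
-- i2 and i3 translate to formulas MH derives from E (outright under the ¬P
-- reading), and on reduced formulas the translation is ′.  As Γ need not be
-- decidable, "the premisses" are A and the finitely many hypotheses actually
-- used by the derivation.
module Submission where

open import Defs
open import Function.Bundles using (_⇔_; mk⇔; Equivalence)

open import Data.Nat using (ℕ; zero; suc; _≡ᵇ_; _+_; _≤_; _<_; _⊔_; s≤s)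
open import Data.Nat.Properties
  using (_≟_; ≡ᵇ⇒≡; +-suc; ≤-trans; m≤m+n; m≤n+m; n≤1+n; <⇒≢; m<n⇒m<1+n; m≤m⊔n; m≤n⊔m; n<1+n)
open import Data.Bool using (true; false; not; T) renaming (_∧_ to _&&_; _∨_ to _||_)
open import Data.Bool.Properties using (∨-zeroʳ; ∨-identityʳ; ∧-identityʳ; T-≡; T-not-≡)
open import Data.Vec using (Vec; []; _∷_; map)
open import Data.Vec.Properties using (map-id; map-∘)
open import Data.Vec.Relation.Unary.All using (All; []; _∷_)
import Data.Vec.Relation.Unary.All as All
open import Data.Product using (Σ; _×_; _,_; proj₂)
open import Data.Sum using (_⊎_; inj₁; inj₂)
open import Data.Empty using (⊥)
open import Data.Unit using (⊤; tt)
open import Function using (_∘_)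
open import Relation.Nullary using (Dec; yes; no; contradiction; _×-dec_; _⊎-dec_)
open import Relation.Binary.PropositionalEquality using (_≡_; refl; sym; trans; cong; cong₂; subst; module ≡-Reasoning)

≡ᵇ-refl : ∀ x → (x ≡ᵇ x) ≡ true
≡ᵇ-refl zero    = refl
≡ᵇ-refl (suc x) = ≡ᵇ-refl x

≡ᵇ-sym : ∀ x y → (x ≡ᵇ y) ≡ (y ≡ᵇ x)
≡ᵇ-sym zero    zero    = refl
≡ᵇ-sym zero    (suc y) = refl
≡ᵇ-sym (suc x) zero    = refl
≡ᵇ-sym (suc x) (suc y) = ≡ᵇ-sym x y

≡ᵇ-true⇒≡ : ∀ {x y} → (x ≡ᵇ y) ≡ true → x ≡ y
≡ᵇ-true⇒≡ {x} {y} e = ≡ᵇ⇒≡ x y (Equivalence.from T-≡ e)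

<⇒≡ᵇ-false : ∀ {k j} → k < j → (k ≡ᵇ j) ≡ false
<⇒≡ᵇ-false {k} {j} k<j with k ≡ᵇ j in eq
... | true  = contradiction (≡ᵇ-true⇒≡ eq) (<⇒≢ k<j)
... | false = refl

>⇒≡ᵇ-false : ∀ {k j} → j < k → (k ≡ᵇ j) ≡ false
>⇒≡ᵇ-false {k} {j} j<k = trans (≡ᵇ-sym k j) (<⇒≡ᵇ-false j<k)

-- Natural deduction inside any Hilbert system containing the positive
-- intuitionistic axioms: G ⊩ X is ⊢ G ⇛ X, where the context G is a
-- right-nested conjunction ending in ⊤ₕ; var₀ and wk address its members.
module Hilbert {Fm : Set} (_⇛_ _&_ _∣_ : Fm → Fm → Fm) (⊥ₕ : Fm) (⊢_ : Fm → Set)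
  (mp : ∀ {A B} → ⊢ A → ⊢ (A ⇛ B) → ⊢ B)
  (ax-K : ∀ A B → ⊢ (A ⇛ (B ⇛ A)))
  (ax-S : ∀ A B C → ⊢ ((A ⇛ (B ⇛ C)) ⇛ ((A ⇛ B) ⇛ (A ⇛ C))))
  (ax-&₁ : ∀ A B → ⊢ ((A & B) ⇛ A))
  (ax-&₂ : ∀ A B → ⊢ ((A & B) ⇛ B))
  (ax-&-intro : ∀ A B C → ⊢ ((C ⇛ A) ⇛ ((C ⇛ B) ⇛ (C ⇛ (A & B)))))
  (ax-∣₁ : ∀ A B → ⊢ (A ⇛ (A ∣ B)))
  (ax-∣₂ : ∀ A B → ⊢ (B ⇛ (A ∣ B)))
  (ax-∣-elim : ∀ A B C → ⊢ ((A ⇛ C) ⇛ ((B ⇛ C) ⇛ ((A ∣ B) ⇛ C))))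
  (ax-efq : ∀ A → ⊢ (⊥ₕ ⇛ A)) where

  ⊢-id : ∀ A → ⊢ (A ⇛ A)
  ⊢-id A = mp (ax-K A A) (mp (ax-K A (A ⇛ A)) (ax-S A (A ⇛ A) A))

  infix 2 _⊩_
  _⊩_ : Fm → Fm → Set
  G ⊩ X = ⊢ (G ⇛ X)

  const : ∀ {G X} → ⊢ X → G ⊩ X
  const {G} {X} p = mp p (ax-K X G)

  app : ∀ {G A B} → G ⊩ (A ⇛ B) → G ⊩ A → G ⊩ B
  app {G} {A} {B} f a = mp a (mp f (ax-S G A B))

  var₀ : ∀ {A G} → (A & G) ⊩ A
  var₀ {A} {G} = ax-&₁ A G

  wk : ∀ {A G X} → G ⊩ X → (A & G) ⊩ X
  wk {A} {G} f = app (const f) (ax-&₂ A G)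

  lam : ∀ {A G B} → (A & G) ⊩ B → G ⊩ (A ⇛ B)
  lam {A} {G} {B} d = compose (app (app (const (ax-&-intro A G A)) (const (⊢-id A))) (ax-K G A)) (const d)
    where
    compose : ∀ {X} → G ⊩ (A ⇛ X) → G ⊩ (X ⇛ B) → G ⊩ (A ⇛ B)
    compose {X} f g = app (app (const (ax-S A X B)) (app (const (ax-K (X ⇛ B) A)) g)) f

  pair : ∀ {G A B} → G ⊩ A → G ⊩ B → G ⊩ (A & B)
  pair {G} {A} {B} a b = mp b (mp a (ax-&-intro A B G))

  fst : ∀ {G A B} → G ⊩ (A & B) → G ⊩ A
  fst {G} {A} {B} = app (const (ax-&₁ A B))

  snd : ∀ {G A B} → G ⊩ (A & B) → G ⊩ B
  snd {G} {A} {B} = app (const (ax-&₂ A B))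

  inl : ∀ {G A B} → G ⊩ A → G ⊩ (A ∣ B)
  inl {G} {A} {B} = app (const (ax-∣₁ A B))

  inr : ∀ {G A B} → G ⊩ B → G ⊩ (A ∣ B)
  inr {G} {A} {B} = app (const (ax-∣₂ A B))

  case : ∀ {G A B C} → G ⊩ (A ∣ B) → (A & G) ⊩ C → (B & G) ⊩ C → G ⊩ C
  case {G} {A} {B} {C} d d₁ d₂ = app (app (app (const (ax-∣-elim A B C)) (lam d₁)) (lam d₂)) d

  efq : ∀ {G A} → G ⊩ ⊥ₕ → G ⊩ A
  efq {G} {A} = app (const (ax-efq A))

  ⊤ₕ : Fm
  ⊤ₕ = ⊥ₕ ⇛ ⊥ₕ

  closed : ∀ {X} → ⊤ₕ ⊩ X → ⊢ X
  closed = mp (⊢-id ⊥ₕ)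

  ⊢-↔-refl : ∀ A → ⊢ ((A ⇛ A) & (A ⇛ A))
  ⊢-↔-refl A = closed (pair (const (⊢-id A)) (const (⊢-id A)))

  ¬ₕ : Fm → Fm
  ¬ₕ A = A ⇛ ⊥ₕ

  ¬¬∣-comm : ∀ A B → ⊢ (¬ₕ (¬ₕ (A ∣ B)) ⇛ ¬ₕ (¬ₕ (B ∣ A)))
  ¬¬∣-comm A B = closed (lam (lam (app (wk var₀)
    (lam (case var₀ (app (wk (wk var₀)) (inr var₀)) (app (wk (wk var₀)) (inl var₀)))))))

  ¬¬-excluded-middle : ∀ A → ⊢ ¬ₕ (¬ₕ (A ∣ ¬ₕ A))
  ¬¬-excluded-middle A = closed (lam (app var₀ (inr (lam (app (wk var₀) (inl var₀))))))

module HilbertI3 (Γ : Form → Set) = Hilbert _⇒_ _⋀_ _⋁_ fls (Γ ⊢i3_) mp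
  (λ A B → ax (ax1 A B)) (λ A B C → ax (ax2 A B C)) (λ A B → ax (ax4 A B)) (λ A B → ax (ax5 A B))
  (λ A B C → ax (ax6 A B C)) (λ A B → ax (ax7 A B)) (λ A B → ax (ax8 A B)) (λ A B C → ax (ax9 A B C))
  (λ A → ax (ax10 A))

module HilbertMH (Δ : FormI → Set) = Hilbert _⇒ᵢ_ _⋀ᵢ_ _⋁ᵢ_ flsI (Δ ⊢mh_) mp
  (λ A B → ax (ax1 A B)) (λ A B C → ax (ax2 A B C)) (λ A B → ax (ax4 A B)) (λ A B → ax (ax5 A B))
  (λ A B C → ax (ax6 A B C)) (λ A B → ax (ax7 A B)) (λ A B → ax (ax8 A B)) (λ A B C → ax (ax9 A B C))
  (λ A → ax (ax10 A))

IsAtomic : Form → Set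
IsAtomic (atom p n ts) = ⊤
IsAtomic fls           = ⊤
IsAtomic _             = ⊥

IsReduced : Form → Set
IsReduced (atom p n ts) = ⊤
IsReduced fls           = ⊤
IsReduced (∼ A)         = IsAtomic A
IsReduced (A ⋀ B)       = IsReduced A × IsReduced B
IsReduced (A ⋁ B)       = IsReduced A × IsReduced B
IsReduced (A ⇒ B)       = IsReduced A × IsReduced B
IsReduced (∀' x A)      = IsReduced A
IsReduced (∃' x A)      = IsReduced A

mutual
  IsReduced-f : ∀ A → IsReduced (f A)
  IsReduced-f (atom p n ts) = tt
  IsReduced-f fls           = tt
  IsReduced-f (∼ A)         = IsReduced-fneg A
  IsReduced-f (A ⋀ B)       = IsReduced-f A , IsReduced-f B
  IsReduced-f (A ⋁ B)       = IsReduced-f A , IsReduced-f B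
  IsReduced-f (A ⇒ B)       = IsReduced-f A , IsReduced-f B
  IsReduced-f (∀' x A)      = IsReduced-f A
  IsReduced-f (∃' x A)      = IsReduced-f A

  IsReduced-fneg : ∀ A → IsReduced (fneg A)
  IsReduced-fneg (atom p n ts) = tt
  IsReduced-fneg fls           = tt
  IsReduced-fneg (∼ A)         = IsReduced-f A
  IsReduced-fneg (A ⋀ B)       = IsReduced-fneg A , IsReduced-fneg B
  IsReduced-fneg (A ⋁ B)       = IsReduced-fneg A , IsReduced-fneg B
  IsReduced-fneg (A ⇒ B)       = (IsReduced-fneg A , tt) , IsReduced-fneg B
  IsReduced-fneg (∀' x A)      = IsReduced-fneg A
  IsReduced-fneg (∃' x A)      = IsReduced-fneg A

Reduced⇒IsReduced : ∀ {A} → Reduced A → IsReduced A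
Reduced⇒IsReduced (B , refl) = IsReduced-f B

unprime : FormI → Form
unprime (atomI false p n ts) = atom p n ts
unprime (atomI true p n ts)  = ∼ atom p n ts
unprime flsI                 = fls
unprime nflsI                = ∼ fls
unprime (A ⋀ᵢ B)             = unprime A ⋀ unprime B
unprime (A ⋁ᵢ B)             = unprime A ⋁ unprime B
unprime (A ⇒ᵢ B)             = unprime A ⇒ unprime B
unprime (∀ᵢ x A)             = ∀' x (unprime A)
unprime (∃ᵢ x A)             = ∃' x (unprime A)

unprime-prime : ∀ A → IsReduced A → unprime (prime A) ≡ A
unprime-prime (atom p n ts)   r       = refl
unprime-prime fls             r       = refl
unprime-prime (∼ atom p n ts) r       = refl
unprime-prime (∼ fls)         r       = refl
unprime-prime (A ⋀ B)         (r , s) = cong₂ _⋀_ (unprime-prime A r) (unprime-prime B s)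
unprime-prime (A ⋁ B)         (r , s) = cong₂ _⋁_ (unprime-prime A r) (unprime-prime B s)
unprime-prime (A ⇒ B)         (r , s) = cong₂ _⇒_ (unprime-prime A r) (unprime-prime B s)
unprime-prime (∀' x A)        r       = cong (∀' x) (unprime-prime A r)
unprime-prime (∃' x A)        r       = cong (∃' x) (unprime-prime A r)

fv-unprime : ∀ x A → fv x (unprime A) ≡ fvI x A
fv-unprime x (atomI false p n ts) = refl
fv-unprime x (atomI true p n ts)  = refl
fv-unprime x flsI                 = refl
fv-unprime x nflsI                = refl
fv-unprime x (A ⋀ᵢ B)             = cong₂ _||_ (fv-unprime x A) (fv-unprime x B)
fv-unprime x (A ⋁ᵢ B)             = cong₂ _||_ (fv-unprime x A) (fv-unprime x B)
fv-unprime x (A ⇒ᵢ B)             = cong₂ _||_ (fv-unprime x A) (fv-unprime x B)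
fv-unprime x (∀ᵢ y A)             = cong (not (x ≡ᵇ y) &&_) (fv-unprime x A)
fv-unprime x (∃ᵢ y A)             = cong (not (x ≡ᵇ y) &&_) (fv-unprime x A)

sub-unprime : ∀ x t A → unprime (subI x t A) ≡ sub x t (unprime A)
sub-unprime x t (atomI false p n ts) = refl
sub-unprime x t (atomI true p n ts)  = refl
sub-unprime x t flsI                 = refl
sub-unprime x t nflsI                = refl
sub-unprime x t (A ⋀ᵢ B)             = cong₂ _⋀_ (sub-unprime x t A) (sub-unprime x t B)
sub-unprime x t (A ⋁ᵢ B)             = cong₂ _⋁_ (sub-unprime x t A) (sub-unprime x t B)
sub-unprime x t (A ⇒ᵢ B)             = cong₂ _⇒_ (sub-unprime x t A) (sub-unprime x t B)
sub-unprime x t (∀ᵢ y A) with x ≡ᵇ y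
... | true  = refl
... | false = cong (∀' y) (sub-unprime x t A)
sub-unprime x t (∃ᵢ y A) with x ≡ᵇ y
... | true  = refl
... | false = cong (∃' y) (sub-unprime x t A)

freeFor-unprime : ∀ t x A → freeFor t x (unprime A) ≡ freeForI t x A
freeFor-unprime t x (atomI false p n ts) = refl
freeFor-unprime t x (atomI true p n ts)  = refl
freeFor-unprime t x flsI                 = refl
freeFor-unprime t x nflsI                = refl
freeFor-unprime t x (A ⋀ᵢ B)             = cong₂ _&&_ (freeFor-unprime t x A) (freeFor-unprime t x B)
freeFor-unprime t x (A ⋁ᵢ B)             = cong₂ _&&_ (freeFor-unprime t x A) (freeFor-unprime t x B)
freeFor-unprime t x (A ⇒ᵢ B)             = cong₂ _&&_ (freeFor-unprime t x A) (freeFor-unprime t x B)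
freeFor-unprime t x (∀ᵢ y A) rewrite fv-unprime x A | freeFor-unprime t x A = refl
freeFor-unprime t x (∃ᵢ y A) rewrite fv-unprime x A | freeFor-unprime t x A = refl

unprime-axiom : ∀ {C} → AxMH C → AxQBDi3 (unprime C)
unprime-axiom (ax1 A B)   = ax1 _ _
unprime-axiom (ax2 A B C) = ax2 _ _ _
unprime-axiom (ax4 A B)   = ax4 _ _
unprime-axiom (ax5 A B)   = ax5 _ _
unprime-axiom (ax6 A B C) = ax6 _ _ _
unprime-axiom (ax7 A B)   = ax7 _ _
unprime-axiom (ax8 A B)   = ax8 _ _
unprime-axiom (ax9 A B C) = ax9 _ _ _
unprime-axiom (ax10 A)    = ax10 _
unprime-axiom (ax11 x t A h) rewrite sub-unprime x t A =
  ax11 x t (unprime A) (subst T (sym (freeFor-unprime t x A)) h)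
unprime-axiom (ax12 x A B h) =
  ax12 x (unprime A) (unprime B) (subst (T ∘ not) (sym (fv-unprime x B)) h)
unprime-axiom (ax13 x A B h) =
  ax13 x (unprime A) (unprime B) (subst (T ∘ not) (sym (fv-unprime x B)) h)
unprime-axiom (ax14 x t A h) rewrite sub-unprime x t A =
  ax14 x t (unprime A) (subst T (sym (freeFor-unprime t x A)) h)
unprime-axiom (ax15 A)    = ax15 _
unprime-axiom (i1 x A)    = i1 x (unprime A)

unprime-derivation : ∀ {Γ Δ} → (∀ {C} → Δ C → Γ ⊢i3 unprime C) →
  ∀ {C} → Δ ⊢mh C → Γ ⊢i3 unprime C
unprime-derivation h (hyp δ)   = h δ
unprime-derivation h (ax a)    = ax (unprime-axiom a)
unprime-derivation h (mp d e)  = mp (unprime-derivation h d) (unprime-derivation h e)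
unprime-derivation h (gen x d) = gen x (unprime-derivation h d)

gen-allFrom : ∀ {Γ} k n X → Γ ⊢i3 unprime X → Γ ⊢i3 unprime (allFrom k n X)
gen-allFrom k zero    X d = d
gen-allFrom k (suc n) X d = gen k (gen-allFrom (suc k) n X d)

⊢i3-unprime-exclAx : ∀ {Γ} p n → Γ ⊢i3 unprime (exclAx p n)
⊢i3-unprime-exclAx p n = gen-allFrom 0 n _ (ax (i2 _))

⊢i3-unprime-lemAx : ∀ {Γ} p n → Γ ⊢i3 unprime (lemAx p n)
⊢i3-unprime-lemAx {Γ} p n = gen-allFrom 0 n _ (mp (ax (i3 _)) (¬¬∣-comm _ _))
  where open HilbertI3 Γ

⊢mh-prime⇒⊢i3 : (Γ : Form → Set) (A : Form) → (∀ B → Γ B → Reduced B) → Reduced A →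
  ((primeSet Γ ∪ᵢ E (Γ ∪｛ A ｝)) ⊢mh prime A) → Γ ⊢i3 A
⊢mh-prime⇒⊢i3 Γ A rΓ rA d =
  subst (Γ ⊢i3_) (unprime-prime A (Reduced⇒IsReduced rA)) (unprime-derivation premiss d)
  where
  premiss : ∀ {C} → (primeSet Γ ∪ᵢ E (Γ ∪｛ A ｝)) C → Γ ⊢i3 unprime C
  premiss (inj₁ (B , g , refl)) =
    subst (Γ ⊢i3_) (sym (unprime-prime B (Reduced⇒IsReduced (rΓ B g)))) (hyp g)
  premiss (inj₂ (p , n , _ , inj₁ refl)) = ⊢i3-unprime-exclAx p n
  premiss (inj₂ (p , n , _ , inj₂ refl)) = ⊢i3-unprime-lemAx p n

subst-var-self : ∀ x t → substT x (var x) t ≡ t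
subst-var-self x (var y) with x ≡ᵇ y in eq
... | true  = cong var (≡ᵇ-true⇒≡ eq)
... | false = refl
subst-var-self x (con c) = refl

map-subst-var-self : ∀ {n} x (ts : Vec Term n) → map (substT x (var x)) ts ≡ ts
map-subst-var-self x []       = refl
map-subst-var-self x (t ∷ ts) = cong₂ _∷_ (subst-var-self x t) (map-subst-var-self x ts)

subI-var-self : ∀ x A → subI x (var x) A ≡ A
subI-var-self x (atomI b p n ts) = cong (atomI b p n) (map-subst-var-self x ts)
subI-var-self x flsI             = refl
subI-var-self x nflsI            = refl
subI-var-self x (A ⋀ᵢ B)         = cong₂ _⋀ᵢ_ (subI-var-self x A) (subI-var-self x B)
subI-var-self x (A ⋁ᵢ B)         = cong₂ _⋁ᵢ_ (subI-var-self x A) (subI-var-self x B)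
subI-var-self x (A ⇒ᵢ B)         = cong₂ _⇒ᵢ_ (subI-var-self x A) (subI-var-self x B)
subI-var-self x (∀ᵢ y A) with x ≡ᵇ y
... | true  = refl
... | false = cong (∀ᵢ y) (subI-var-self x A)
subI-var-self x (∃ᵢ y A) with x ≡ᵇ y
... | true  = refl
... | false = cong (∃ᵢ y) (subI-var-self x A)

freeForI-var-self : ∀ x A → freeForI (var x) x A ≡ true
freeForI-var-self x (atomI b p n ts) = refl
freeForI-var-self x flsI             = refl
freeForI-var-self x nflsI            = refl
freeForI-var-self x (A ⋀ᵢ B) rewrite freeForI-var-self x A | freeForI-var-self x B = refl
freeForI-var-self x (A ⋁ᵢ B) rewrite freeForI-var-self x A | freeForI-var-self x B = refl
freeForI-var-self x (A ⇒ᵢ B) rewrite freeForI-var-self x A | freeForI-var-self x B = refl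
freeForI-var-self x (∀ᵢ y A) with x ≡ᵇ y | ≡ᵇ-sym y x
... | true  | _   = refl
... | false | y≠x rewrite y≠x | freeForI-var-self x A = ∨-zeroʳ _
freeForI-var-self x (∃ᵢ y A) with x ≡ᵇ y | ≡ᵇ-sym y x
... | true  | _   = refl
... | false | y≠x rewrite y≠x | freeForI-var-self x A = ∨-zeroʳ _

module QuantifierMH (Δ : FormI → Set) where
  open HilbertMH Δ public

  ∀-intro : ∀ {G A} x → fvI x G ≡ false → G ⊩ A → G ⊩ ∀ᵢ x A
  ∀-intro {G} {A} x x∉G d = mp (gen x d) (ax (ax13 x A G (Equivalence.from T-not-≡ x∉G)))

  ∀-elim : ∀ {G A} x → G ⊩ ∀ᵢ x A → G ⊩ A
  ∀-elim {G} {A} x d = subst (G ⊩_) (subI-var-self x A)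
    (app (const (ax (ax14 x (var x) A (Equivalence.from T-≡ (freeForI-var-self x A))))) d)

  ∃-intro : ∀ {G A} x → G ⊩ A → G ⊩ ∃ᵢ x A
  ∃-intro {G} {A} x d = app (const (ax (ax11 x (var x) A (Equivalence.from T-≡ (freeForI-var-self x A)))))
    (subst (G ⊩_) (sym (subI-var-self x A)) d)

  ∃-elim : ∀ {G A C} x → G ⊩ ∃ᵢ x A → (A ⋀ᵢ G) ⊩ C → fvI x G ≡ false → fvI x C ≡ false → G ⊩ C
  ∃-elim {G} {A} {C} x e d x∉G x∉C =
    app (app (const (ax (ax12 x A C (Equivalence.from T-not-≡ x∉C)))) (∀-intro x x∉G (lam d))) e

  ⊢∼⊥ : Δ ⊢mh nflsI
  ⊢∼⊥ = mp (⊢-id flsI) (ax (ax15 _))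

Avoids : ℕ → ℕ → Term → Set
Avoids k zero    t = ⊤
Avoids k (suc m) t = occT k t ≡ false × Avoids (suc k) m t

substFrom : ∀ {m} → ℕ → Vec Term m → Term → Term
substFrom k []       t = t
substFrom k (w ∷ ws) t = substFrom (suc k) ws (substT k w t)

substT-fresh : ∀ x s t → occT x t ≡ false → substT x s t ≡ t
substT-fresh x s (var y) x∉t rewrite x∉t = refl
substT-fresh x s (con c) _   = refl

substFrom-fresh : ∀ {m} k (ws : Vec Term m) t → Avoids k m t → substFrom k ws t ≡ t
substFrom-fresh k []       t _         = refl
substFrom-fresh k (w ∷ ws) t (k∉t , a) rewrite substT-fresh k w t k∉t = substFrom-fresh (suc k) ws t a

map-substT-varsFrom : ∀ k j m w → k < j → map (substT k w) (varsFrom j m) ≡ varsFrom j m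
map-substT-varsFrom k j zero    w k<j = refl
map-substT-varsFrom k j (suc m) w k<j rewrite <⇒≡ᵇ-false k<j =
  cong (var j ∷_) (map-substT-varsFrom k (suc j) m w (m<n⇒m<1+n k<j))

map-substFrom-varsFrom : ∀ k m (ws : Vec Term m) → All (Avoids k m) ws →
  map (substFrom k ws) (varsFrom k m) ≡ ws
map-substFrom-varsFrom k zero    []       []       = refl
map-substFrom-varsFrom k (suc m) (w ∷ ws) (a ∷ as) = cong₂ _∷_ head tail
  where
  head : substFrom k (w ∷ ws) (var k) ≡ w
  head rewrite ≡ᵇ-refl k = substFrom-fresh (suc k) ws w (proj₂ a)
  tail : map (substFrom k (w ∷ ws)) (varsFrom (suc k) m) ≡ ws
  tail = begin
    map (substFrom (suc k) ws ∘ substT k w) (varsFrom (suc k) m)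
      ≡⟨ map-∘ (substFrom (suc k) ws) (substT k w) (varsFrom (suc k) m) ⟩
    map (substFrom (suc k) ws) (map (substT k w) (varsFrom (suc k) m))
      ≡⟨ cong (map (substFrom (suc k) ws)) (map-substT-varsFrom k (suc k) m w (n<1+n k)) ⟩
    map (substFrom (suc k) ws) (varsFrom (suc k) m)
      ≡⟨ map-substFrom-varsFrom (suc k) m ws (All.map proj₂ as) ⟩
    ws ∎
    where open ≡-Reasoning

varBound : Term → ℕ
varBound (var j) = suc j
varBound (con _) = 0

varsBound : ∀ {l} → Vec Term l → ℕ
varsBound []       = 0
varsBound (t ∷ ts) = varBound t ⊔ varsBound ts

Avoids-varBound≤ : ∀ k m t → varBound t ≤ k → Avoids k m t
Avoids-varBound≤ k zero    t       _ = tt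
Avoids-varBound≤ k (suc m) (var j) b = >⇒≡ᵇ-false b , Avoids-varBound≤ (suc k) m (var j) (≤-trans b (n≤1+n k))
Avoids-varBound≤ k (suc m) (con c) b = refl , Avoids-varBound≤ (suc k) m (con c) (≤-trans b (n≤1+n k))

Avoids-var : ∀ k m j → k + m ≤ j → Avoids k m (var j)
Avoids-var k zero    j _ = tt
Avoids-var k (suc m) j b rewrite +-suc k m =
  <⇒≡ᵇ-false (≤-trans (s≤s (m≤m+n k m)) b) , Avoids-var (suc k) m j b

All-Avoids-varsBound≤ : ∀ {l} k m (ts : Vec Term l) → varsBound ts ≤ k → All (Avoids k m) ts
All-Avoids-varsBound≤ k m []       _ = []
All-Avoids-varsBound≤ k m (t ∷ ts) b =
  Avoids-varBound≤ k m t (≤-trans (m≤m⊔n (varBound t) (varsBound ts)) b) ∷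
  All-Avoids-varsBound≤ k m ts (≤-trans (m≤n⊔m (varBound t) (varsBound ts)) b)

All-Avoids-varsFrom : ∀ k m j l → k + m ≤ j → All (Avoids k m) (varsFrom j l)
All-Avoids-varsFrom k m j zero    _ = []
All-Avoids-varsFrom k m j (suc l) b = Avoids-var k m j b ∷ All-Avoids-varsFrom k m (suc j) l (≤-trans b (n≤1+n j))

subI-allFrom : ∀ k j m w X → k < j → subI k w (allFrom j m X) ≡ allFrom j m (subI k w X)
subI-allFrom k j zero    w X _   = refl
subI-allFrom k j (suc m) w X k<j rewrite <⇒≡ᵇ-false k<j =
  cong (∀ᵢ j) (subI-allFrom k (suc j) m w X (m<n⇒m<1+n k<j))

freeForI-allFrom : ∀ w x j m X → Avoids j m w → freeForI w x X ≡ true → freeForI w x (allFrom j m X) ≡ true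
freeForI-allFrom w x j zero    X _         free = free
freeForI-allFrom w x j (suc m) X (j∉w , a) free rewrite j∉w | freeForI-allFrom w x (suc j) m X a free = ∨-zeroʳ _

genI-allFrom : ∀ {Δ} k m X → Δ ⊢mh X → Δ ⊢mh allFrom k m X
genI-allFrom k zero    X d = d
genI-allFrom k (suc m) X d = gen k (genI-allFrom (suc k) m X d)

module Instantiation (Δ : FormI → Set) {l} (Φ : Vec Term l → FormI)
  (subI-Φ : ∀ x t us → subI x t (Φ us) ≡ Φ (map (substT x t) us))
  (freeForI-Φ : ∀ t x us → freeForI t x (Φ us) ≡ true) where

  instantiate : ∀ k m (ws : Vec Term m) (us : Vec Term l) → All (Avoids k m) ws →
    Δ ⊢mh allFrom k m (Φ us) → Δ ⊢mh Φ (map (substFrom k ws) us)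
  instantiate k zero [] us [] d = subst (λ v → Δ ⊢mh Φ v) (sym (map-id us)) d
  instantiate k (suc m) (w ∷ ws) us (a ∷ as) d =
    subst (λ v → Δ ⊢mh Φ v) (sym (map-∘ (substFrom (suc k) ws) (substT k w) us))
      (instantiate (suc k) m ws (map (substT k w) us) (All.map proj₂ as) instance-at-w)
    where
    free : T (freeForI w k (allFrom (suc k) m (Φ us)))
    free = Equivalence.from T-≡ (freeForI-allFrom w k (suc k) m (Φ us) (proj₂ a) (freeForI-Φ w k us))
    instance-at-w : Δ ⊢mh allFrom (suc k) m (Φ (map (substT k w) us))
    instance-at-w =
      subst (Δ ⊢mh_) (trans (subI-allFrom k (suc k) m w (Φ us) (n<1+n k)) (cong (allFrom (suc k) m) (subI-Φ k w us)))
        (mp d (ax (ax14 k w _ free)))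

  instantiate-varsFrom : ∀ k (ws : Vec Term l) → All (Avoids k l) ws →
    Δ ⊢mh allFrom k l (Φ (varsFrom k l)) → Δ ⊢mh Φ ws
  instantiate-varsFrom k ws as d =
    subst (λ v → Δ ⊢mh Φ v) (map-substFrom-varsFrom k l ws as) (instantiate k l ws (varsFrom k l) as d)

  -- Instantiating x_0 … x_{l-1} directly at ts could capture variables of ts,
  -- so they are first renamed to variables x_F … beyond those of ts.
  instance-of-closure : (ts : Vec Term l) → Δ ⊢mh allFrom 0 l (Φ (varsFrom 0 l)) → Δ ⊢mh Φ ts
  instance-of-closure ts d =
    instantiate-varsFrom F ts (All-Avoids-varsBound≤ F l ts (m≤m+n (varsBound ts) l))
      (genI-allFrom F l _ (instantiate-varsFrom 0 (varsFrom F l) (All-Avoids-varsFrom 0 l F l (m≤n+m l (varsBound ts))) d))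
    where
    F = varsBound ts + l

negatedAtom : ∀ {X : Set} → Dec X → ℕ → (n : ℕ) → Vec Term n → FormI
negatedAtom (yes _) p n ts = atomI true p n ts
negatedAtom (no _)  p n ts = ¬ᵢ (atomI false p n ts)

module Translation {S : ℕ → ℕ → Set} (S? : ∀ p n → Dec (S p n)) where
  mutual
    tr : Form → FormI
    tr (atom p n ts) = atomI false p n ts
    tr fls           = flsI
    tr (∼ A)         = tr∼ A
    tr (A ⋀ B)       = tr A ⋀ᵢ tr B
    tr (A ⋁ B)       = tr A ⋁ᵢ tr B
    tr (A ⇒ B)       = tr A ⇒ᵢ tr B
    tr (∀' x A)      = ∀ᵢ x (tr A)
    tr (∃' x A)      = ∃ᵢ x (tr A)

    tr∼ : Form → FormI
    tr∼ (atom p n ts) = negatedAtom (S? p n) p n ts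
    tr∼ fls           = nflsI
    tr∼ (∼ A)         = tr A
    tr∼ (A ⋀ B)       = tr∼ A ⋁ᵢ tr∼ B
    tr∼ (A ⋁ B)       = tr∼ A ⋀ᵢ tr∼ B
    tr∼ (A ⇒ B)       = ¬ᵢ (tr∼ A) ⋀ᵢ tr∼ B
    tr∼ (∀' x A)      = ∃ᵢ x (tr∼ A)
    tr∼ (∃' x A)      = ∀ᵢ x (tr∼ A)

  mutual
    fv-tr : ∀ x A → fvI x (tr A) ≡ fv x A
    fv-tr x (atom p n ts) = refl
    fv-tr x fls           = refl
    fv-tr x (∼ A)         = fv-tr∼ x A
    fv-tr x (A ⋀ B)       = cong₂ _||_ (fv-tr x A) (fv-tr x B)
    fv-tr x (A ⋁ B)       = cong₂ _||_ (fv-tr x A) (fv-tr x B)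
    fv-tr x (A ⇒ B)       = cong₂ _||_ (fv-tr x A) (fv-tr x B)
    fv-tr x (∀' y A)      = cong (not (x ≡ᵇ y) &&_) (fv-tr x A)
    fv-tr x (∃' y A)      = cong (not (x ≡ᵇ y) &&_) (fv-tr x A)

    fv-tr∼ : ∀ x A → fvI x (tr∼ A) ≡ fv x A
    fv-tr∼ x (atom p n ts) with S? p n
    ... | yes _ = refl
    ... | no _  = ∨-identityʳ _
    fv-tr∼ x fls          = refl
    fv-tr∼ x (∼ A)        = fv-tr x A
    fv-tr∼ x (A ⋀ B)      = cong₂ _||_ (fv-tr∼ x A) (fv-tr∼ x B)
    fv-tr∼ x (A ⋁ B)      = cong₂ _||_ (fv-tr∼ x A) (fv-tr∼ x B)
    fv-tr∼ x (A ⇒ B)      = cong₂ _||_ (trans (∨-identityʳ _) (fv-tr∼ x A)) (fv-tr∼ x B)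
    fv-tr∼ x (∀' y A)     = cong (not (x ≡ᵇ y) &&_) (fv-tr∼ x A)
    fv-tr∼ x (∃' y A)     = cong (not (x ≡ᵇ y) &&_) (fv-tr∼ x A)

  mutual
    sub-tr : ∀ x t A → subI x t (tr A) ≡ tr (sub x t A)
    sub-tr x t (atom p n ts) = refl
    sub-tr x t fls           = refl
    sub-tr x t (∼ A)         = sub-tr∼ x t A
    sub-tr x t (A ⋀ B)       = cong₂ _⋀ᵢ_ (sub-tr x t A) (sub-tr x t B)
    sub-tr x t (A ⋁ B)       = cong₂ _⋁ᵢ_ (sub-tr x t A) (sub-tr x t B)
    sub-tr x t (A ⇒ B)       = cong₂ _⇒ᵢ_ (sub-tr x t A) (sub-tr x t B)
    sub-tr x t (∀' y A) with x ≡ᵇ y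
    ... | true  = refl
    ... | false = cong (∀ᵢ y) (sub-tr x t A)
    sub-tr x t (∃' y A) with x ≡ᵇ y
    ... | true  = refl
    ... | false = cong (∃ᵢ y) (sub-tr x t A)

    sub-tr∼ : ∀ x t A → subI x t (tr∼ A) ≡ tr∼ (sub x t A)
    sub-tr∼ x t (atom p n ts) with S? p n
    ... | yes _ = refl
    ... | no _  = refl
    sub-tr∼ x t fls     = refl
    sub-tr∼ x t (∼ A)   = sub-tr x t A
    sub-tr∼ x t (A ⋀ B) = cong₂ _⋁ᵢ_ (sub-tr∼ x t A) (sub-tr∼ x t B)
    sub-tr∼ x t (A ⋁ B) = cong₂ _⋀ᵢ_ (sub-tr∼ x t A) (sub-tr∼ x t B)
    sub-tr∼ x t (A ⇒ B) = cong₂ _⋀ᵢ_ (cong ¬ᵢ (sub-tr∼ x t A)) (sub-tr∼ x t B)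
    sub-tr∼ x t (∀' y A) with x ≡ᵇ y
    ... | true  = refl
    ... | false = cong (∃ᵢ y) (sub-tr∼ x t A)
    sub-tr∼ x t (∃' y A) with x ≡ᵇ y
    ... | true  = refl
    ... | false = cong (∀ᵢ y) (sub-tr∼ x t A)

  mutual
    freeFor-tr : ∀ t x A → freeForI t x (tr A) ≡ freeFor t x A
    freeFor-tr t x (atom p n ts) = refl
    freeFor-tr t x fls           = refl
    freeFor-tr t x (∼ A)         = freeFor-tr∼ t x A
    freeFor-tr t x (A ⋀ B)       = cong₂ _&&_ (freeFor-tr t x A) (freeFor-tr t x B)
    freeFor-tr t x (A ⋁ B)       = cong₂ _&&_ (freeFor-tr t x A) (freeFor-tr t x B)
    freeFor-tr t x (A ⇒ B)       = cong₂ _&&_ (freeFor-tr t x A) (freeFor-tr t x B)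
    freeFor-tr t x (∀' y A) rewrite fv-tr x A | freeFor-tr t x A = refl
    freeFor-tr t x (∃' y A) rewrite fv-tr x A | freeFor-tr t x A = refl

    freeFor-tr∼ : ∀ t x A → freeForI t x (tr∼ A) ≡ freeFor t x A
    freeFor-tr∼ t x (atom p n ts) with S? p n
    ... | yes _ = refl
    ... | no _  = refl
    freeFor-tr∼ t x fls     = refl
    freeFor-tr∼ t x (∼ A)   = freeFor-tr t x A
    freeFor-tr∼ t x (A ⋀ B) = cong₂ _&&_ (freeFor-tr∼ t x A) (freeFor-tr∼ t x B)
    freeFor-tr∼ t x (A ⋁ B) = cong₂ _&&_ (freeFor-tr∼ t x A) (freeFor-tr∼ t x B)
    freeFor-tr∼ t x (A ⇒ B) = cong₂ _&&_ (trans (∧-identityʳ _) (freeFor-tr∼ t x A)) (freeFor-tr∼ t x B)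
    freeFor-tr∼ t x (∀' y A) rewrite fv-tr∼ x A | freeFor-tr∼ t x A = refl
    freeFor-tr∼ t x (∃' y A) rewrite fv-tr∼ x A | freeFor-tr∼ t x A = refl

  tr-prime : ∀ B → IsReduced B → (∀ {p n} → NegOccurs p n B → S p n) → tr B ≡ prime B
  tr-prime (atom p n ts)   r       c = refl
  tr-prime fls             r       c = refl
  tr-prime (∼ atom p n ts) r       c with S? p n
  ... | yes _ = refl
  ... | no ¬s = contradiction (c (inj₁ (refl , refl))) ¬s
  tr-prime (∼ fls)         r       c = refl
  tr-prime (A ⋀ B)         (r , s) c = cong₂ _⋀ᵢ_ (tr-prime A r (c ∘ inj₁)) (tr-prime B s (c ∘ inj₂))
  tr-prime (A ⋁ B)         (r , s) c = cong₂ _⋁ᵢ_ (tr-prime A r (c ∘ inj₁)) (tr-prime B s (c ∘ inj₂))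
  tr-prime (A ⇒ B)         (r , s) c = cong₂ _⇒ᵢ_ (tr-prime A r (c ∘ inj₁)) (tr-prime B s (c ∘ inj₂))
  tr-prime (∀' x A)        r       c = cong (∀ᵢ x) (tr-prime A r c)
  tr-prime (∃' x A)        r       c = cong (∃ᵢ x) (tr-prime A r c)

NegUsed : ∀ {Γ C} → ℕ → ℕ → Γ ⊢i3 C → Set
NegUsed p n (hyp {B} _) = NegOccurs p n B
NegUsed p n (ax _)      = ⊥
NegUsed p n (mp d e)    = NegUsed p n d ⊎ NegUsed p n e
NegUsed p n (gen _ d)   = NegUsed p n d

module TranslatedDerivations {S : ℕ → ℕ → Set} (S? : ∀ p n → Dec (S p n)) (Δ : FormI → Set)
  (excl : ∀ {p n} → S p n → ∀ ts → Δ ⊢mh (atomI true p n ts ⇒ᵢ ¬ᵢ (atomI false p n ts)))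
  (lem : ∀ {p n} → S p n → ∀ ts → Δ ⊢mh ¬ᵢ (¬ᵢ (atomI true p n ts ⋁ᵢ atomI false p n ts))) where
  open Translation S?
  open QuantifierMH Δ

  mutual
    tr-i2 : ∀ A → Δ ⊢mh (tr∼ A ⇒ᵢ ¬ᵢ (tr A))
    tr-i2 (atom p n ts) with S? p n
    ... | yes s = excl s ts
    ... | no _  = ⊢-id _
    tr-i2 fls     = closed (lam (lam var₀))
    tr-i2 (∼ A)   = closed (lam (lam (app (app (const (tr-i2 A)) var₀) (wk var₀))))
    tr-i2 (A ⋀ B) = closed (lam (lam (case (wk var₀)
      (app (app (const (tr-i2 A)) var₀) (fst (wk var₀)))
      (app (app (const (tr-i2 B)) var₀) (snd (wk var₀))))))
    tr-i2 (A ⋁ B) = closed (lam (lam (case var₀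
      (app (app (const (tr-i2 A)) (fst (wk (wk var₀)))) var₀)
      (app (app (const (tr-i2 B)) (snd (wk (wk var₀)))) var₀))))
    tr-i2 (A ⇒ B) = closed (lam (lam (app (const (tr-i3 A)) (lam (case var₀
      (app (app (const (tr-i2 B)) (snd (wk (wk (wk var₀))))) (app (wk (wk var₀)) var₀))
      (app (fst (wk (wk (wk var₀)))) var₀))))))
    tr-i2 (∀' x A) = closed (lam (lam (∃-elim x (wk var₀)
      (app (app (const (tr-i2 A)) var₀) (∀-elim x (wk var₀))) x∉context refl)))
      where
      x∉context : fvI x (∀ᵢ x (tr A) ⋀ᵢ (∃ᵢ x (tr∼ A) ⋀ᵢ ⊤ₕ)) ≡ false
      x∉context rewrite ≡ᵇ-refl x = refl
    tr-i2 (∃' x A) = closed (lam (lam (∃-elim x var₀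
      (app (app (const (tr-i2 A)) (∀-elim x (wk (wk var₀)))) var₀) x∉context refl)))
      where
      x∉context : fvI x (∃ᵢ x (tr A) ⋀ᵢ (∀ᵢ x (tr∼ A) ⋀ᵢ ⊤ₕ)) ≡ false
      x∉context rewrite ≡ᵇ-refl x = refl

    tr-i3 : ∀ A → Δ ⊢mh ¬ᵢ (¬ᵢ (tr A ⋁ᵢ tr∼ A))
    tr-i3 (atom p n ts) with S? p n
    ... | yes s = mp (lem s ts) (¬¬∣-comm _ _)
    ... | no _  = ¬¬-excluded-middle _
    tr-i3 fls     = closed (lam (app var₀ (inr (const ⊢∼⊥))))
    tr-i3 (∼ A)   = mp (tr-i3 A) (¬¬∣-comm _ _)
    tr-i3 (A ⋀ B) = closed (lam (app (const (tr-i3 A)) (lam (case var₀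
      (app (const (tr-i3 B)) (lam (case var₀
        (app (wk (wk (wk (wk var₀)))) (inl (pair (wk (wk var₀)) var₀)))
        (app (wk (wk (wk (wk var₀)))) (inr (inr var₀))))))
      (app (wk (wk var₀)) (inr (inl var₀)))))))
    tr-i3 (A ⋁ B) = closed (lam (app (const (tr-i3 A)) (lam (case var₀
      (app (wk (wk var₀)) (inl (inl var₀)))
      (app (const (tr-i3 B)) (lam (case var₀
        (app (wk (wk (wk (wk var₀)))) (inl (inr var₀)))
        (app (wk (wk (wk (wk var₀)))) (inr (pair (wk (wk var₀)) var₀))))))))))
    tr-i3 (A ⇒ B) = closed (lam (app (const (tr-i3 B)) (lam (case var₀
      (app (wk (wk var₀)) (inl (lam (wk var₀))))
      (app (const (tr-i3 A)) (lam (case var₀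
        (app (wk (wk (wk (wk var₀))))
          (inr (pair (lam (app (app (const (tr-i2 A)) var₀) (wk var₀))) (wk (wk var₀)))))
        (app (wk (wk (wk (wk var₀))))
          (inl (lam (efq (app (app (const (tr-i2 A)) (wk var₀)) var₀))))))))))))
    tr-i3 (∀' x A) = closed (lam (app (app (const (ax (i1 x (tr A))))
        (∀-intro x x∉context (lam (app (const (tr-i3 A)) (lam (case var₀
          (app (wk (wk var₀)) var₀)
          (app (wk (wk (wk var₀))) (inr (∃-intro x var₀)))))))))
      (lam (app (wk var₀) (inl var₀)))))
      where
      x∉context : fvI x (¬ᵢ (∀ᵢ x (tr A) ⋁ᵢ ∃ᵢ x (tr∼ A)) ⋀ᵢ ⊤ₕ) ≡ false
      x∉context rewrite ≡ᵇ-refl x = refl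
    tr-i3 (∃' x A) = closed (lam (app (app (const (ax (i1 x (tr∼ A))))
        (∀-intro x x∉context (lam (app (const (tr-i3 A)) (lam (case var₀
          (app (wk (wk (wk var₀))) (inl (∃-intro x var₀)))
          (app (wk (wk var₀)) var₀)))))))
      (lam (app (wk var₀) (inr var₀)))))
      where
      x∉context : fvI x (¬ᵢ (∃ᵢ x (tr A) ⋁ᵢ ∀ᵢ x (tr∼ A)) ⋀ᵢ ⊤ₕ) ≡ false
      x∉context rewrite ≡ᵇ-refl x = refl

  -- tr pushes ∼ inwards exactly as Ax16–Ax21 do, so both sides of each of
  -- them have the same translation.
  tr-axiom : ∀ {C} → AxQBDi3 C → Δ ⊢mh tr C
  tr-axiom (ax1 A B)      = ax (ax1 _ _)
  tr-axiom (ax2 A B C)    = ax (ax2 _ _ _)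
  tr-axiom (ax4 A B)      = ax (ax4 _ _)
  tr-axiom (ax5 A B)      = ax (ax5 _ _)
  tr-axiom (ax6 A B C)    = ax (ax6 _ _ _)
  tr-axiom (ax7 A B)      = ax (ax7 _ _)
  tr-axiom (ax8 A B)      = ax (ax8 _ _)
  tr-axiom (ax9 A B C)    = ax (ax9 _ _ _)
  tr-axiom (ax10 A)       = ax (ax10 _)
  tr-axiom (ax11 x t A h) rewrite sym (sub-tr x t A) = ax (ax11 x t (tr A) (subst T (sym (freeFor-tr t x A)) h))
  tr-axiom (ax12 x A B h) = ax (ax12 x (tr A) (tr B) (subst (T ∘ not) (sym (fv-tr x B)) h))
  tr-axiom (ax13 x A B h) = ax (ax13 x (tr A) (tr B) (subst (T ∘ not) (sym (fv-tr x B)) h))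
  tr-axiom (ax14 x t A h) rewrite sym (sub-tr x t A) = ax (ax14 x t (tr A) (subst T (sym (freeFor-tr t x A)) h))
  tr-axiom (ax15 A)       = ax (ax15 _)
  tr-axiom (ax16 A)       = ⊢-↔-refl _
  tr-axiom (ax17 A B)     = ⊢-↔-refl _
  tr-axiom (ax18 A B)     = ⊢-↔-refl _
  tr-axiom (ax19 A B)     = ⊢-↔-refl _
  tr-axiom (ax20 x A)     = ⊢-↔-refl _
  tr-axiom (ax21 x A)     = ⊢-↔-refl _
  tr-axiom (i1 x A)       = ax (i1 x (tr A))
  tr-axiom (i2 A)         = tr-i2 A
  tr-axiom (i3 A)         = tr-i3 A

  tr-derivation : ∀ {Γ C} →
    (∀ {B} → Γ B → (∀ {p n} → NegOccurs p n B → S p n) → Δ ⊢mh tr B) →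
    (d : Γ ⊢i3 C) → (∀ {p n} → NegUsed p n d → S p n) → Δ ⊢mh tr C
  tr-derivation tr-hyp (hyp g)   used = tr-hyp g used
  tr-derivation tr-hyp (ax a)    used = tr-axiom a
  tr-derivation tr-hyp (mp d e)  used = mp (tr-derivation tr-hyp d (used ∘ inj₁)) (tr-derivation tr-hyp e (used ∘ inj₂))
  tr-derivation tr-hyp (gen x d) used = gen x (tr-derivation tr-hyp d used)

isAtom? : ∀ p n A → Dec (IsAtom p n A)
isAtom? p n (atom q m ts) = (p ≟ q) ×-dec (n ≟ m)
isAtom? p n fls           = no λ ()
isAtom? p n (∼ A)         = no λ ()
isAtom? p n (A ⋀ B)       = no λ ()
isAtom? p n (A ⋁ B)       = no λ ()
isAtom? p n (A ⇒ B)       = no λ ()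
isAtom? p n (∀' x A)      = no λ ()
isAtom? p n (∃' x A)      = no λ ()

negOccurs? : ∀ p n A → Dec (NegOccurs p n A)
negOccurs? p n (atom q m ts) = no λ ()
negOccurs? p n fls           = no λ ()
negOccurs? p n (∼ A)         = isAtom? p n A ⊎-dec negOccurs? p n A
negOccurs? p n (A ⋀ B)       = negOccurs? p n A ⊎-dec negOccurs? p n B
negOccurs? p n (A ⋁ B)       = negOccurs? p n A ⊎-dec negOccurs? p n B
negOccurs? p n (A ⇒ B)       = negOccurs? p n A ⊎-dec negOccurs? p n B
negOccurs? p n (∀' x A)      = negOccurs? p n A
negOccurs? p n (∃' x A)      = negOccurs? p n A

negUsed? : ∀ {Γ C} p n (d : Γ ⊢i3 C) → Dec (NegUsed p n d)
negUsed? p n (hyp {B} _) = negOccurs? p n B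
negUsed? p n (ax _)      = no λ ()
negUsed? p n (mp d e)    = negUsed? p n d ⊎-dec negUsed? p n e
negUsed? p n (gen _ d)   = negUsed? p n d

negUsed⇒hyp : ∀ {Γ C p n} (d : Γ ⊢i3 C) → NegUsed p n d → Σ Form (λ B → Γ B × NegOccurs p n B)
negUsed⇒hyp (hyp {B} g) o        = B , g , o
negUsed⇒hyp (mp d e)    (inj₁ u) = negUsed⇒hyp d u
negUsed⇒hyp (mp d e)    (inj₂ u) = negUsed⇒hyp e u
negUsed⇒hyp (gen _ d)   u        = negUsed⇒hyp d u

⊢i3⇒⊢mh-prime : (Γ : Form → Set) (A : Form) → (∀ B → Γ B → Reduced B) → Reduced A →
  Γ ⊢i3 A → ((primeSet Γ ∪ᵢ E (Γ ∪｛ A ｝)) ⊢mh prime A)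
⊢i3⇒⊢mh-prime Γ A rΓ rA d =
  subst (Δ ⊢mh_) (tr-prime A (Reduced⇒IsReduced rA) inj₁) (tr-derivation tr-hyp d inj₂)
  where
  Δ : FormI → Set
  Δ = primeSet Γ ∪ᵢ E (Γ ∪｛ A ｝)

  S : ℕ → ℕ → Set
  S p n = NegOccurs p n A ⊎ NegUsed p n d

  S? : ∀ p n → Dec (S p n)
  S? p n = negOccurs? p n A ⊎-dec negUsed? p n d

  negated-premiss : ∀ {p n} → S p n → Σ Form (λ B → (Γ ∪｛ A ｝) B × NegOccurs p n B)
  negated-premiss (inj₁ o) = A , inj₂ refl , o
  negated-premiss (inj₂ u) with negUsed⇒hyp d u
  ... | B , g , o = B , inj₁ g , o

  excl : ∀ {p n} → S p n → ∀ ts → Δ ⊢mh (atomI true p n ts ⇒ᵢ ¬ᵢ (atomI false p n ts))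
  excl {p} {n} s ts = Instantiation.instance-of-closure Δ (λ us → atomI true p n us ⇒ᵢ ¬ᵢ (atomI false p n us))
    (λ _ _ _ → refl) (λ _ _ _ → refl) ts (hyp (inj₂ (p , n , negated-premiss s , inj₁ refl)))

  lem : ∀ {p n} → S p n → ∀ ts → Δ ⊢mh ¬ᵢ (¬ᵢ (atomI true p n ts ⋁ᵢ atomI false p n ts))
  lem {p} {n} s ts = Instantiation.instance-of-closure Δ (λ us → ¬ᵢ (¬ᵢ (atomI true p n us ⋁ᵢ atomI false p n us)))
    (λ _ _ _ → refl) (λ _ _ _ → refl) ts (hyp (inj₂ (p , n , negated-premiss s , inj₂ refl)))

  open Translation S?
  open TranslatedDerivations S? Δ excl lem

  tr-hyp : ∀ {B} → Γ B → (∀ {p n} → NegOccurs p n B → S p n) → Δ ⊢mh tr B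
  tr-hyp {B} g c = subst (Δ ⊢mh_) (sym (tr-prime B (Reduced⇒IsReduced (rΓ B g)) c)) (hyp (inj₁ (B , g , refl)))

proposition3p6 : (Γ : Form → Set) (A : Form) →
    (∀ B → Γ B → Reduced B) → Reduced A →
    (Γ ⊢i3 A) ⇔ ((primeSet Γ ∪ᵢ E (Γ ∪｛ A ｝)) ⊢mh prime A)
proposition3p6 Γ A rΓ rA = mk⇔ (⊢i3⇒⊢mh-prime Γ A rΓ rA) (⊢mh-prime⇒⊢i3 Γ A rΓ rA)
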